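{- For every integer $b\geq 2$, every positive integer $d$ and every $x\ge 1$, \[ \#\{n\in\mathcal{P}_b(x): d\mid n\}\ll_b \frac{|\mathcal{P}_b(x)|}{\sqrt{d}},\qquad \#\{n\in\mathcal{P}_b^*(x): d\mid n\}\ll_b \frac{|\mathcal{P}_b^*(x)|}{\sqrt{d}}, \] where the implied constants depend only on $b$.
   Context: Fix an integer base $b\geq 2$. For a positive integer $n$ with $N$ base-$b$ digits, $n=\sum_{0\leq i<N}n_ib^i$ with $0\le n_i<b$, $n_{N-1}\neq0$, its digital reverse is $\overleftarrow{n}=\sum_{0\leq i<N}n_ib^{N-1-i}$. Let $\mathcal{P}_b(x)=\{n\leq x:\ b\nmid n,\ n=\overleftarrow{n}\}$ and $\mathcal{P}_b^*(x)=\{n\leq x:\ \gcd(n,b^3-b)=1,\ n=\overleftarrow{n}\}$ (with $n$ positive integers). -}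

module Defs where

open import Data.Nat using (ℕ; zero; suc; _+_; _*_; _∸_; _^_; _≡ᵇ_; NonZero)
open import Data.Nat.DivMod using (_%_; _/_)
open import Data.Nat.Divisibility using (_∣?_)
open import Data.Nat.GCD using (gcd)
open import Data.Bool using (Bool; true; false; not; _∧_; if_then_else_)
open import Data.List using (List; []; _∷_; foldl)
open import Relation.Nullary using (does)

digitsF : (b : ℕ) → .{{NonZero b}} → ℕ → ℕ → List ℕ
digitsF b zero    m       = []
digitsF b (suc f) zero    = []
digitsF b (suc f) (suc m) = (suc m % b) ∷ digitsF b f (suc m / b)

-- digits n = [n_0, n_1, ..., n_{N-1}] (fuel n suffices since b ≥ 2).
digits : (b : ℕ) → .{{NonZero b}} → ℕ → List ℕ
digits b n = digitsF b n n

-- digital reverse: sum_i n_i b^{N-1-i}  (Horner with n_0 most significant)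
rev : (b : ℕ) → .{{NonZero b}} → ℕ → ℕ
rev b n = foldl (λ acc c → acc * b + c) 0 (digits b n)

inP : (b : ℕ) → .{{NonZero b}} → ℕ → Bool
inP b n = not (does (b ∣? n)) ∧ (rev b n ≡ᵇ n)

inP* : (b : ℕ) → .{{NonZero b}} → ℕ → Bool
inP* b n = (gcd n (b ^ 3 ∸ b) ≡ᵇ 1) ∧ (rev b n ≡ᵇ n)

count : (ℕ → Bool) → ℕ → ℕ
count p zero    = 0
count p (suc x) = (if p (suc x) then 1 else 0) + count p x

divB : ℕ → ℕ → Bool
divB d n = does (d ∣? n)

-- Upper bound: a palindrome n with N+1 digits lies in an interval of length b^(N+1−t) fixed by
-- its last t digits, so a multiple of d among them is determined by n mod d·b^t together with a
-- quotient taking at most b^(N+1−t)/(d·b^t) + 2 values: there are at most b^(N+1−t)/d + 2·b^t.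
-- With b^e ≤ d and t ≈ (N+1−e)/2, summing over N gives #{n ∈ P_b(x) : d ∣ n}²·d ≤ 144·b³·x.
-- Lower bound: for each digit string F of length 2r+1, suitable digits a, c, m make the palindrome
-- 1 a c F m F̃ c a 1 congruent to 1 modulo b and modulo b²−1 (where b² ≡ 1), hence coprime to
-- b³−b; these are b^(2r+1) elements of P*_b(b^(4r+9)), so x ≤ b^13·|P*_b(x)|².
-- As P*_b ⊆ P_b, both estimates hold with C = 144·b^16.

{-# OPTIONS --safe #-}
module Submission where

open import Defs
open import Data.Bool using (Bool; true; false; T; _∧_; not)
open import Data.Bool.Properties using (T-∧)
open import Data.Empty using (⊥-elim)
open import Data.List using (List; []; _∷_; _++_; _∷ʳ_; [_]; length; reverse; foldr; foldl; take; drop; upTo; applyDownFrom; filterᵇ)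
open import Data.List.Membership.Propositional using (_∈_)
open import Data.List.Membership.Propositional.Properties
  using (∈-upTo⁺; ∈-upTo⁻; ∈-applyDownFrom⁺; ∈-applyDownFrom⁻; ∈-filter⁺; ∈-filter⁻)
open import Data.List.Properties
  using (length-removeAt′; length-upTo; reverse-foldl; reverse-involutive; length-++; length-reverse; length-take;
         length-drop; take++drop≡id; reverse-++; unfold-reverse; ++-assoc)
open import Data.List.Relation.Unary.All as All using (All; []; _∷_)
import Data.List.Relation.Unary.All.Properties as All
open import Data.List.Relation.Unary.Any using (here; there; _─_)
open import Data.List.Relation.Unary.Unique.Propositional using (Unique; []; _∷_)
import Data.List.Relation.Unary.Unique.Propositional.Properties as Unique
open import Data.Nat
open import Data.Nat.Coprimality using (Coprime; coprime-divisor; coprime⇒gcd≡1)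
open import Data.Nat.DivMod
open import Data.Nat.Divisibility using (_∣_; _∣?_; divides; %-presˡ-∣; ∣⇒≤; ∣1⇒≡1; ∣-trans; m∣m*n; n∣m*n)
open import Data.Nat.GCD using (gcd; gcd-greatest)
open import Data.Nat.Properties
open import Data.Nat.Tactic.RingSolver using (solve-∀)
open import Data.Product using (∃; _×_; _,_; proj₁; proj₂)
open import Function using (_∘_)
open import Function.Bundles using (module Equivalence)
open import Relation.Binary.Bundles using (Setoid)
import Relation.Binary.Construct.On as On
open import Relation.Binary.PropositionalEquality hiding ([_])
import Relation.Binary.Reasoning.Setoid as SetoidReasoning
open import Relation.Nullary using (¬_; does; yes; no; contradiction)
open import Relation.Nullary.Decidable using (T?)

[m+kn]%n≡m : ∀ {m} k n .{{_ : NonZero n}} → m < n → (m + k * n) % n ≡ m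
[m+kn]%n≡m {m} k n m<n = trans ([m+kn]%n≡m%n m k n) (m<n⇒m%n≡m m<n)

[m+kn]/n≡k : ∀ {m} k n .{{_ : NonZero n}} → m < n → (m + k * n) / n ≡ k
[m+kn]/n≡k {m} k n m<n = begin
  (m + k * n) / n    ≡⟨ +-distrib-/-∣ʳ m (divides k refl) ⟩
  m / n + k * n / n  ≡⟨ cong₂ _+_ (m<n⇒m/n≡0 m<n) (m*n/n≡m k n) ⟩
  k                  ∎
  where open ≡-Reasoning

m+kn-injective : ∀ {m m′} k k′ n .{{_ : NonZero n}} → m < n → m′ < n → m + k * n ≡ m′ + k′ * n → m ≡ m′ × k ≡ k′
m+kn-injective k k′ n m<n m′<n eq =
  trans (sym ([m+kn]%n≡m k n m<n)) (trans (cong (_% n) eq) ([m+kn]%n≡m k′ n m′<n)) ,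
  trans (sym ([m+kn]/n≡k k n m<n)) (trans (cong (_/ n) eq) ([m+kn]/n≡k k′ n m′<n))

m*[n/m+2]≤n+2*m : ∀ m n .{{_ : NonZero m}} → m * (n / m + 2) ≤ n + 2 * m
m*[n/m+2]≤n+2*m m n = begin
  m * (n / m + 2)     ≡⟨ *-distribˡ-+ m (n / m) 2 ⟩
  m * (n / m) + m * 2 ≡⟨ cong₂ _+_ (*-comm m (n / m)) (*-comm m 2) ⟩
  n / m * m + 2 * m   ≤⟨ +-monoˡ-≤ (2 * m) (m/n*n≤m n m) ⟩
  n + 2 * m           ∎
  where open ≤-Reasoning

m*n≤o⇒m≤o/n : ∀ {m n o} .{{_ : NonZero n}} → m * n ≤ o → m ≤ o / n
m*n≤o⇒m≤o/n {m} {n} m*n≤o = subst (_≤ _) (m*n/n≡m m n) (/-monoˡ-≤ n m*n≤o)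

m<[1+m/n]*n : ∀ m n .{{_ : NonZero n}} → m < suc (m / n) * n
m<[1+m/n]*n m n = begin-strict
  m                 ≡⟨ m≡m%n+[m/n]*n m n ⟩
  m % n + m / n * n <⟨ +-monoˡ-< _ (m%n<n m n) ⟩
  suc (m / n) * n   ∎
  where open ≤-Reasoning

n/o∸m/o<w/o+2 : ∀ {m n} w o .{{_ : NonZero o}} → n ≤ m + w → n / o ∸ m / o < w / o + 2
n/o∸m/o<w/o+2 {m} {n} w o n≤m+w = begin-strict
  n / o ∸ m / o              ≤⟨ ∸-monoˡ-≤ (m / o) (/-monoˡ-≤ o n≤m+w) ⟩
  (m + w) / o ∸ m / o        <⟨ ∸-monoˡ-< (m<n*o⇒m/o<n m+w<) (/-monoˡ-≤ o (m≤m+n m w)) ⟩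
  m / o + (w / o + 2) ∸ m / o ≡⟨ m+n∸m≡n (m / o) _ ⟩
  w / o + 2                  ∎
  where
  open ≤-Reasoning
  regroup : ∀ x y o → suc x * o + suc y * o ≡ (x + (y + 2)) * o
  regroup = solve-∀
  m+w< : m + w < (m / o + (w / o + 2)) * o
  m+w< = begin-strict
    m + w                                   <⟨ +-mono-< (m<[1+m/n]*n m o) (m<[1+m/n]*n w o) ⟩
    suc (m / o) * o + suc (w / o) * o       ≡⟨ regroup (m / o) (w / o) o ⟩
    (m / o + (w / o + 2)) * o               ∎

⌈n/2⌉-bounds : ∀ n → n ≤ ⌈ n /2⌉ + ⌈ n /2⌉ × ⌈ n /2⌉ + ⌈ n /2⌉ ≤ suc n
⌈n/2⌉-bounds n =
  subst (_≤ ⌈ n /2⌉ + ⌈ n /2⌉) (⌊n/2⌋+⌈n/2⌉≡n n) (+-monoˡ-≤ ⌈ n /2⌉ (⌊n/2⌋≤⌈n/2⌉ n)) ,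
  subst (⌈ n /2⌉ + ⌈ n /2⌉ ≤_) (⌊n/2⌋+⌈n/2⌉≡n (suc n)) (+-monoʳ-≤ ⌈ n /2⌉ (⌊n/2⌋≤⌈n/2⌉ (suc n)))

T-∧-monoˡ : ∀ {x x′ y} → (T x → T x′) → T (x ∧ y) → T (x′ ∧ y)
T-∧-monoˡ {true}  {true}  _    h = h
T-∧-monoˡ {true}  {false} x⇒x′ _ = x⇒x′ _
T-∧-monoˡ {false} _ ()

divB⇒∣ : ∀ {d n} → T (divB d n) → d ∣ n
divB⇒∣ {d} {n} h with d ∣? n
... | yes d∣n = d∣n
... | no  _   = ⊥-elim h

%≡1⇒coprime : ∀ {n m} .{{_ : NonZero m}} → n % m ≡ 1 → Coprime n m
%≡1⇒coprime n%m≡1 (i∣n , i∣m) = ∣1⇒≡1 (subst (_ ∣_) n%m≡1 (%-presˡ-∣ i∣n i∣m))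

coprime-* : ∀ {n m o} → Coprime n m → Coprime n o → Coprime n (m * o)
coprime-* {n} {m} n⊥m n⊥o {i} (i∣n , i∣m*o) = n⊥o (i∣n , coprime-divisor i⊥m i∣m*o)
  where
  i⊥m : Coprime i m
  i⊥m (j∣i , j∣m) = n⊥m (∣-trans j∣i i∣n , j∣m)

All-reverse⁺ : ∀ {P : ℕ → Set} {xs} → All P xs → All P (reverse xs)
All-reverse⁺ [] = []
All-reverse⁺ {P} {x ∷ xs} (px ∷ pxs) = subst (All P) (sym (unfold-reverse x xs)) (All.∷ʳ⁺ (All-reverse⁺ pxs) px)

reverse-odd-palindrome : ∀ {A : Set} (h : List A) (m : A) → reverse (h ++ m ∷ reverse h) ≡ h ++ m ∷ reverse h
reverse-odd-palindrome h m = begin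
  reverse (h ++ m ∷ reverse h)             ≡⟨ reverse-++ h (m ∷ reverse h) ⟩
  reverse (m ∷ reverse h) ++ reverse h     ≡⟨ cong (_++ reverse h) (unfold-reverse m (reverse h)) ⟩
  (reverse (reverse h) ∷ʳ m) ++ reverse h  ≡⟨ cong (λ xs → (xs ∷ʳ m) ++ reverse h) (reverse-involutive h) ⟩
  (h ∷ʳ m) ++ reverse h                    ≡⟨ ++-assoc h [ m ] (reverse h) ⟩
  h ++ m ∷ reverse h                       ∎
  where open ≡-Reasoning

∈-─⁺ : ∀ {A : Set} {x y} {ys : List A} (x∈ys : x ∈ ys) → y ∈ ys → y ≢ x → y ∈ (ys ─ x∈ys)
∈-─⁺ (here refl) (here refl) y≢x = contradiction refl y≢x
∈-─⁺ (here refl) (there y∈ys) _ = y∈ys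
∈-─⁺ (there x∈ys) (here refl) _ = here refl
∈-─⁺ (there x∈ys) (there y∈ys) y≢x = there (∈-─⁺ x∈ys y∈ys y≢x)

injective⇒length-≤ : ∀ {A B : Set} {xs : List A} {ys : List B} (f : A → B) → Unique xs →
  (∀ {x y} → x ∈ xs → y ∈ xs → f x ≡ f y → x ≡ y) → (∀ {x} → x ∈ xs → f x ∈ ys) →
  length xs ≤ length ys
injective⇒length-≤ {xs = []} f _ _ _ = z≤n
injective⇒length-≤ {xs = x ∷ xs} {ys} f (x∉xs ∷ xs!) inj into =
  ≤-trans (s≤s (injective⇒length-≤ f xs! (λ p q → inj (there p) (there q)) into′))
          (≤-reflexive (sym (length-removeAt′ ys _)))
  where
  fx∈ys = into (here refl)
  into′ : ∀ {y} → y ∈ xs → f y ∈ (ys ─ fx∈ys)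
  into′ y∈xs = ∈-─⁺ fx∈ys (into (there y∈xs))
    (λ fy≡fx → All.lookup x∉xs y∈xs (sym (inj (there y∈xs) (here refl) fy≡fx)))

window : ℕ → ℕ → List ℕ
window lo k = applyDownFrom (λ i → suc (lo + i)) k

window-unique : ∀ lo k → Unique (window lo k)
window-unique lo k = Unique.applyDownFrom⁺₁ _ k
  (λ j<i _ eq → <⇒≢ j<i (sym (+-cancelˡ-≡ lo _ _ (suc-injective eq))))

∈-window⁻ : ∀ {lo k n} → n ∈ window lo k → lo < n × n ≤ lo + k
∈-window⁻ {lo} n∈ with i , i<k , refl ← ∈-applyDownFrom⁻ _ n∈ =
  s≤s (m≤m+n lo _) , +-monoʳ-< lo i<k

∈-window⁺ : ∀ {n x} → 0 < n → n ≤ x → n ∈ window 0 x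
∈-window⁺ {suc n} _ n<x = ∈-applyDownFrom⁺ _ n<x

count-window : ∀ p lo k → count p (lo + k) ≡ length (filterᵇ p (window lo k)) + count p lo
count-window p lo zero = cong (count p) (+-identityʳ lo)
count-window p lo (suc k) rewrite +-suc lo k with p (suc (lo + k))
... | true  = cong suc (count-window p lo k)
... | false = count-window p lo k

module _ (p : ℕ → Bool) (lo hi : ℕ) where

  InWindow : ℕ → Set
  InWindow n = lo < n × n ≤ hi × T (p n)

  count-window-≤ : lo ≤ hi → ∀ Y (f : ℕ → ℕ) → (∀ {n} → InWindow n → f n < Y) →
    (∀ {m n} → InWindow m → InWindow n → f m ≡ f n → m ≡ n) →
    count p hi ≤ Y + count p lo
  count-window-≤ lo≤hi Y f f<Y f-inj with k , refl ← m≤n⇒∃[o]m+o≡n lo≤hi = begin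
    count p (lo + k)                               ≡⟨ count-window p lo k ⟩
    length (filterᵇ p (window lo k)) + count p lo  ≤⟨ +-monoˡ-≤ _ counted≤Y ⟩
    length (upTo Y) + count p lo                   ≡⟨ cong (_+ count p lo) (length-upTo Y) ⟩
    Y + count p lo                                 ∎
    where
    open ≤-Reasoning
    inWindow : ∀ {n} → n ∈ filterᵇ p (window lo k) → InWindow n
    inWindow n∈ with n∈w , pn ← ∈-filter⁻ (T? ∘ p) n∈ with lo<n , n≤ ← ∈-window⁻ n∈w = lo<n , n≤ , pn
    counted≤Y = injective⇒length-≤ f (Unique.filter⁺ (T? ∘ p) (window-unique lo k))
      (λ m∈ n∈ → f-inj (inWindow m∈) (inWindow n∈)) (∈-upTo⁺ ∘ f<Y ∘ inWindow)

≤-count : ∀ p x K (g : ℕ → ℕ) → (∀ {i} → i < K → 0 < g i × g i ≤ x × T (p (g i))) →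
  (∀ {i j} → i < K → j < K → g i ≡ g j → i ≡ j) → K ≤ count p x
≤-count p x K g g∈ g-inj = begin
  K                                   ≡⟨ length-upTo K ⟨
  length (upTo K)                     ≤⟨ injective⇒length-≤ g (Unique.upTo⁺ K) g-inj′ into ⟩
  length (filterᵇ p (window 0 x))     ≤⟨ m≤m+n _ _ ⟩
  length (filterᵇ p (window 0 x)) + 0 ≡⟨ count-window p 0 x ⟨
  count p x                           ∎
  where
  open ≤-Reasoning
  g-inj′ : ∀ {i j} → i ∈ upTo K → j ∈ upTo K → g i ≡ g j → i ≡ j
  g-inj′ i∈ j∈ = g-inj (∈-upTo⁻ i∈) (∈-upTo⁻ j∈)
  into : ∀ {i} → i ∈ upTo K → g i ∈ filterᵇ p (window 0 x)
  into i∈ with 0<gi , gi≤x , pgi ← g∈ (∈-upTo⁻ i∈) = ∈-filter⁺ (T? ∘ p) (∈-window⁺ 0<gi gi≤x) pgi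

count-monoʳ : ∀ p {x y} → x ≤ y → count p x ≤ count p y
count-monoʳ p {x} x≤y with k , refl ← m≤n⇒∃[o]m+o≡n x≤y =
  ≤-trans (m≤n+m _ _) (≤-reflexive (sym (count-window p x k)))

count-monoˡ : ∀ {p q} x → (∀ n → T (p n) → T (q n)) → count p x ≤ count q x
count-monoˡ zero _ = z≤n
count-monoˡ {p} {q} (suc x) p⇒q with p (suc x) | q (suc x) | p⇒q (suc x)
... | true  | true  | _   = s≤s (count-monoˡ x p⇒q)
... | true  | false | p⇒⊥ = ⊥-elim (p⇒⊥ _)
... | false | true  | _   = m≤n⇒m≤1+n (count-monoˡ x p⇒q)
... | false | false | _   = count-monoˡ x p⇒q

count-zero : ∀ p x → (∀ n → 0 < n → n ≤ x → ¬ T (p n)) → count p x ≡ 0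
count-zero p zero _ = refl
count-zero p (suc x) none with p (suc x) | none (suc x) (s≤s z≤n) ≤-refl
... | true  | ¬true = ⊥-elim (¬true _)
... | false | _     = count-zero p x λ n 0<n n≤x → none n 0<n (m≤n⇒m≤1+n n≤x)

module _ (p : ℕ → Bool) (lo hi : ℕ) {d k} .{{_ : NonZero d}} .{{_ : NonZero k}} (W : ℕ) (start : ℕ → ℕ) where
  private instance _ = m*n≢0 d k

  -- n is determined by its residue r = n % (d·k), a multiple of d, together with
  -- n / (d·k) ∸ start r / (d·k), which is less than W / (d·k) + 2.
  count-≤-by-residue : lo ≤ hi →
    (∀ {n} → InWindow p lo hi n → d ∣ n × start (n % (d * k)) ≤ n × n ≤ start (n % (d * k)) + W) →
    count p hi ≤ W / d + 2 * k + count p lo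
  count-≤-by-residue lo≤hi located =
    ≤-trans (count-window-≤ p lo hi lo≤hi (k * U) code code<k*U code-injective) (+-monoˡ-≤ _ k*U≤)
    where
    L = d * k
    U = W / L + 2
    instance _ = >-nonZero (≤-trans (s≤s z≤n) (m≤n+m 2 (W / L)))
    r u v code : ℕ → ℕ
    r n = n % L
    u n = n / L ∸ start (r n) / L
    v n = r n / d
    code n = u n + v n * U
    module _ {n} (n∈ : InWindow p lo hi n) where
      u<U : u n < U
      u<U = n/o∸m/o<w/o+2 W L (proj₂ (proj₂ (located n∈)))
      d*v≡r : d * v n ≡ r n
      d*v≡r = m*[n/m]≡n (%-presˡ-∣ (proj₁ (located n∈)) (m∣m*n k))
      v<k : v n < k
      v<k = m<n*o⇒m/o<n (subst (r n <_) (*-comm d k) (m%n<n n L))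
      n≡ : n ≡ r n + (u n + start (r n) / L) * L
      n≡ = trans (m≡m%n+[m/n]*n n L) (cong (λ l → r n + l * L) (sym (m∸n+n≡m (/-monoˡ-≤ L (proj₁ (proj₂ (located n∈)))))))
    k*U≤ : k * U ≤ W / d + 2 * k
    k*U≤ = subst (λ l → k * (l + 2) ≤ W / d + 2 * k) (m/n/o≡m/[n*o] W d k) (m*[n/m+2]≤n+2*m k (W / d))
    code<k*U : ∀ {n} → InWindow p lo hi n → code n < k * U
    code<k*U n∈ = <-≤-trans (+-monoˡ-< _ (u<U n∈)) (*-monoˡ-≤ U (v<k n∈))
    code-injective : ∀ {m n} → InWindow p lo hi m → InWindow p lo hi n → code m ≡ code n → m ≡ n
    code-injective {m} {n} m∈ n∈ code≡ with u≡ , v≡ ← m+kn-injective (v m) (v n) U (u<U m∈) (u<U n∈) code≡ = begin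
      m                                      ≡⟨ n≡ m∈ ⟩
      r m + (u m + start (r m) / L) * L      ≡⟨ cong₂ (λ r′ u′ → r′ + (u′ + start r′ / L) * L) r≡ u≡ ⟩
      r n + (u n + start (r n) / L) * L      ≡⟨ n≡ n∈ ⟨
      n                                      ∎
      where
      open ≡-Reasoning
      r≡ : r m ≡ r n
      r≡ = trans (sym (d*v≡r m∈)) (trans (cong (d *_) v≡) (d*v≡r n∈))

module Congruence (q : ℕ) .{{_ : NonZero q}} where

  ≋-setoid : Setoid _ _
  ≋-setoid = On.setoid (setoid ℕ) (_% q)

  open Setoid ≋-setoid public using () renaming (_≈_ to _≋_; refl to ≋-refl; sym to ≋-sym)

  module ≋-Reasoning = SetoidReasoning ≋-setoid

  %-≋ : ∀ x → x % q ≋ x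
  %-≋ x = m%n%n≡m%n x q

  +-≋ : ∀ {x x′ y y′} → x ≋ x′ → y ≋ y′ → x + y ≋ x′ + y′
  +-≋ {x} {x′} {y} {y′} x≋x′ y≋y′ = begin
    (x + y) % q                  ≡⟨ %-distribˡ-+ x y q ⟩
    (x % q + y % q) % q          ≡⟨ cong₂ (λ u v → (u + v) % q) x≋x′ y≋y′ ⟩
    (x′ % q + y′ % q) % q        ≡⟨ %-distribˡ-+ x′ y′ q ⟨
    (x′ + y′) % q                ∎
    where open ≡-Reasoning

  *-≋ : ∀ {x x′ y y′} → x ≋ x′ → y ≋ y′ → x * y ≋ x′ * y′
  *-≋ {x} {x′} {y} {y′} x≋x′ y≋y′ = begin
    (x * y) % q                  ≡⟨ %-distribˡ-* x y q ⟩
    (x % q * (y % q)) % q        ≡⟨ cong₂ (λ u v → (u * v) % q) x≋x′ y≋y′ ⟩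
    (x′ % q * (y′ % q)) % q      ≡⟨ %-distribˡ-* x′ y′ q ⟨
    (x′ * y′) % q                ∎
    where open ≡-Reasoning

module BaseDigits (b : ℕ) .{{_ : NonZero b}} where

  fromDigits : List ℕ → ℕ
  fromDigits = foldr (λ c acc → acc * b + c) 0

  lowDigits : ℕ → ℕ → List ℕ
  lowDigits zero    m = []
  lowDigits (suc ℓ) m = m % b ∷ lowDigits ℓ (m / b)

  Digits : List ℕ → Set
  Digits = All (_< b)

  length-lowDigits : ∀ ℓ m → length (lowDigits ℓ m) ≡ ℓ
  length-lowDigits zero    m = refl
  length-lowDigits (suc ℓ) m = cong suc (length-lowDigits ℓ (m / b))

  lowDigits-digits : ∀ ℓ m → Digits (lowDigits ℓ m)
  lowDigits-digits zero    m = []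
  lowDigits-digits (suc ℓ) m = m%n<n m b ∷ lowDigits-digits ℓ (m / b)

  fromDigits-lowDigits : ∀ ℓ {m} → m < b ^ ℓ → fromDigits (lowDigits ℓ m) ≡ m
  fromDigits-lowDigits zero    m<1 = sym (n<1⇒n≡0 m<1)
  fromDigits-lowDigits (suc ℓ) {m} m<b^1+ℓ = begin
    fromDigits (lowDigits ℓ (m / b)) * b + m % b  ≡⟨ cong (λ v → v * b + m % b) (fromDigits-lowDigits ℓ m/b<b^ℓ) ⟩
    m / b * b + m % b                             ≡⟨ +-comm _ (m % b) ⟩
    m % b + m / b * b                             ≡⟨ m≡m%n+[m/n]*n m b ⟨
    m                                             ∎
    where
    open ≡-Reasoning
    m/b<b^ℓ = m<n*o⇒m/o<n (subst (m <_) (*-comm b (b ^ ℓ)) m<b^1+ℓ)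

  lowDigits-fromDigits : ∀ {ds} → Digits ds → lowDigits (length ds) (fromDigits ds) ≡ ds
  lowDigits-fromDigits [] = refl
  lowDigits-fromDigits {c ∷ cs} (c<b ∷ cs<b) rewrite +-comm (fromDigits cs * b) c =
    cong₂ _∷_ ([m+kn]%n≡m (fromDigits cs) b c<b)
              (trans (cong (lowDigits (length cs)) ([m+kn]/n≡k (fromDigits cs) b c<b)) (lowDigits-fromDigits cs<b))

  fromDigits-< : ∀ {ds} → Digits ds → fromDigits ds < b ^ length ds
  fromDigits-< [] = s≤s z≤n
  fromDigits-< {c ∷ cs} (c<b ∷ cs<b) = begin-strict
    fromDigits cs * b + c  <⟨ +-monoʳ-< _ c<b ⟩
    fromDigits cs * b + b  ≡⟨ +-comm _ b ⟩
    suc (fromDigits cs) * b ≤⟨ *-monoˡ-≤ b (fromDigits-< cs<b) ⟩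
    b ^ length cs * b      ≡⟨ *-comm _ b ⟩
    b ^ length (c ∷ cs)    ∎
    where open ≤-Reasoning

  fromDigits-++ : ∀ xs ys → fromDigits (xs ++ ys) ≡ fromDigits xs + fromDigits ys * b ^ length xs
  fromDigits-++ [] ys = sym (*-identityʳ _)
  fromDigits-++ (x ∷ xs) ys = begin
    fromDigits (xs ++ ys) * b + x                             ≡⟨ cong (λ v → v * b + x) (fromDigits-++ xs ys) ⟩
    (fromDigits xs + fromDigits ys * b ^ length xs) * b + x   ≡⟨ shift (fromDigits xs) (fromDigits ys) x b (b ^ length xs) ⟩
    (fromDigits xs * b + x) + fromDigits ys * (b * b ^ length xs) ∎
    where
    open ≡-Reasoning
    shift : ∀ u v x b p → (u + v * p) * b + x ≡ (u * b + x) + v * (b * p)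
    shift = solve-∀

  module _ {xs k} (xs<b : Digits xs) (ys : List ℕ) (|xs|≡k : length xs ≡ k) where
    private
      instance _ = m^n≢0 b k
      split : fromDigits (xs ++ ys) ≡ fromDigits xs + fromDigits ys * b ^ k
      split = subst (λ e → fromDigits (xs ++ ys) ≡ fromDigits xs + fromDigits ys * b ^ e) |xs|≡k (fromDigits-++ xs ys)
      xs<b^k : fromDigits xs < b ^ k
      xs<b^k = subst (λ e → fromDigits xs < b ^ e) |xs|≡k (fromDigits-< xs<b)

    fromDigits-++-% : fromDigits (xs ++ ys) % b ^ k ≡ fromDigits xs
    fromDigits-++-% = trans (cong (_% b ^ k) split) ([m+kn]%n≡m (fromDigits ys) (b ^ k) xs<b^k)

    fromDigits-++-/ : fromDigits (xs ++ ys) / b ^ k ≡ fromDigits ys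
    fromDigits-++-/ = trans (cong (_/ b ^ k) split) ([m+kn]/n≡k (fromDigits ys) (b ^ k) xs<b^k)

  rev≡fromDigits-reverse : ∀ n → rev b n ≡ fromDigits (reverse (digits b n))
  rev≡fromDigits-reverse n = begin
    foldl step 0 ds                     ≡⟨ cong (foldl step 0) (reverse-involutive ds) ⟨
    foldl step 0 (reverse (reverse ds)) ≡⟨ reverse-foldl step 0 (reverse ds) ⟩
    fromDigits (reverse ds)             ∎
    where
    open ≡-Reasoning
    ds = digits b n
    step = λ acc c → acc * b + c

  b^length≤fromDigits-∷ʳ : ∀ ds {c} → 0 < c → b ^ length ds ≤ fromDigits (ds ∷ʳ c)
  b^length≤fromDigits-∷ʳ ds {c} 0<c = begin
    b ^ length ds                               ≤⟨ m≤n*m (b ^ length ds) c {{>-nonZero 0<c}} ⟩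
    c * b ^ length ds                           ≤⟨ m≤n+m _ (fromDigits ds) ⟩
    fromDigits ds + (0 * b + c) * b ^ length ds ≡⟨ fromDigits-++ ds (c ∷ []) ⟨
    fromDigits (ds ∷ʳ c)                        ∎
    where open ≤-Reasoning

  mirror : ℕ → ℕ → ℕ
  mirror t m = fromDigits (reverse (lowDigits t m))

  module _ {ds : List ℕ} {ℓ} (t : ℕ) (|ds|≡ℓ : length ds ≡ ℓ) where
    private instance
      _ = m^n≢0 b t
      _ = m^n≢0 b (ℓ ∸ t)

    palindrome-/ : Digits ds → reverse ds ≡ ds → t ≤ ℓ →
      fromDigits ds / b ^ (ℓ ∸ t) ≡ mirror t (fromDigits ds % b ^ t)
    palindrome-/ ds<b palindrome t≤ℓ = begin
      fromDigits ds / b ^ (ℓ ∸ t)                            ≡⟨ cong (λ xs → fromDigits xs / b ^ (ℓ ∸ t)) ds≡hi′++lo′ ⟩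
      fromDigits (reverse hi ++ reverse lo) / b ^ (ℓ ∸ t)    ≡⟨ fromDigits-++-/ (All-reverse⁺ (All.drop⁺ t ds<b)) (reverse lo) |hi′| ⟩
      fromDigits (reverse lo)                                 ≡⟨ cong (fromDigits ∘ reverse) lowDigits-lo ⟨
      mirror t (fromDigits lo)                                ≡⟨ cong (mirror t) (fromDigits-++-% (All.take⁺ t ds<b) hi |lo|) ⟨
      mirror t (fromDigits (lo ++ hi) % b ^ t)                ≡⟨ cong (λ xs → mirror t (fromDigits xs % b ^ t)) (take++drop≡id t ds) ⟩
      mirror t (fromDigits ds % b ^ t)                        ∎
      where
      open ≡-Reasoning
      lo = take t ds
      hi = drop t ds
      |lo| : length lo ≡ t
      |lo| = trans (length-take t ds) (m≤n⇒m⊓n≡m (subst (t ≤_) (sym |ds|≡ℓ) t≤ℓ))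
      |hi′| : length (reverse hi) ≡ ℓ ∸ t
      |hi′| = trans (length-reverse hi) (trans (length-drop t ds) (cong (_∸ t) |ds|≡ℓ))
      ds≡hi′++lo′ : ds ≡ reverse hi ++ reverse lo
      ds≡hi′++lo′ = begin
        ds                   ≡⟨ palindrome ⟨
        reverse ds           ≡⟨ cong reverse (take++drop≡id t ds) ⟨
        reverse (lo ++ hi)   ≡⟨ reverse-++ lo hi ⟩
        reverse hi ++ reverse lo ∎
      lowDigits-lo : lowDigits t (fromDigits lo) ≡ lo
      lowDigits-lo = subst (λ k → lowDigits k (fromDigits lo) ≡ lo) |lo| (lowDigits-fromDigits (All.take⁺ t ds<b))

  module _ (1<b : 1 < b) where

    digitsF-lowDigits : ∀ N {f n} → b ^ N ≤ n → n < b ^ suc N → n ≤ f → digitsF b f n ≡ lowDigits (suc N) n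
    digitsF-lowDigits N {n = zero} b^N≤0 _ _ = contradiction b^N≤0 (<⇒≱ (m^n>0 b N))
    digitsF-lowDigits N {zero} {suc n} _ _ ()
    digitsF-lowDigits zero {suc f} {suc n} _ n<b _ rewrite m<n⇒m/n≡0 (subst (suc n <_) (*-identityʳ b) n<b) with f
    ... | zero  = refl
    ... | suc _ = refl
    digitsF-lowDigits (suc N) {suc f} {suc n} b^1+N≤n n<b^2+N (s≤s n≤f) =
      cong (suc n % b ∷_) (digitsF-lowDigits N b^N≤n/b n/b<b^1+N n/b≤f)
      where
      b^N≤n/b = m*n≤o⇒m≤o/n (subst (_≤ suc n) (*-comm b (b ^ N)) b^1+N≤n)
      n/b<b^1+N = m<n*o⇒m/o<n (subst (suc n <_) (*-comm b (b ^ suc N)) n<b^2+N)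
      n/b≤f = ≤-trans (<⇒≤pred (m/n<m (suc n) b 1<b)) n≤f

    digits≡lowDigits : ∀ N {n} → b ^ N ≤ n → n < b ^ suc N → digits b n ≡ lowDigits (suc N) n
    digits≡lowDigits N b^N≤n n<b^1+N = digitsF-lowDigits N b^N≤n n<b^1+N ≤-refl

    digits-fromDigits : ∀ {ds c} → Digits ds → 0 < c → c < b → digits b (fromDigits (ds ∷ʳ c)) ≡ ds ∷ʳ c
    digits-fromDigits {ds} {c} ds<b 0<c c<b = begin
      digits b (fromDigits (ds ∷ʳ c))                      ≡⟨ digits≡lowDigits (length ds) (b^length≤fromDigits-∷ʳ ds 0<c) n<b^1+N ⟩
      lowDigits (suc (length ds)) (fromDigits (ds ∷ʳ c))   ≡⟨ cong (λ ℓ → lowDigits ℓ (fromDigits (ds ∷ʳ c))) |ds∷ʳc| ⟨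
      lowDigits (length (ds ∷ʳ c)) (fromDigits (ds ∷ʳ c))  ≡⟨ lowDigits-fromDigits dsc<b ⟩
      ds ∷ʳ c                                              ∎
      where
      open ≡-Reasoning
      dsc<b = All.∷ʳ⁺ ds<b c<b
      |ds∷ʳc| : length (ds ∷ʳ c) ≡ suc (length ds)
      |ds∷ʳc| = trans (length-++ ds) (+-comm (length ds) 1)
      n<b^1+N = subst (λ k → fromDigits (ds ∷ʳ c) < b ^ k) |ds∷ʳc| (fromDigits-< dsc<b)

    palindrome-lowDigits : ∀ N {n} → b ^ N ≤ n → n < b ^ suc N → rev b n ≡ n →
      reverse (lowDigits (suc N) n) ≡ lowDigits (suc N) n
    palindrome-lowDigits N {n} b^N≤n n<b^1+N rev≡n = begin
      reverse ds                                         ≡⟨ lowDigits-fromDigits (All-reverse⁺ (lowDigits-digits (suc N) n)) ⟨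
      lowDigits (length (reverse ds)) (fromDigits (reverse ds)) ≡⟨ cong₂ lowDigits |ds′| fromDigits-ds′ ⟩
      lowDigits (suc N) n                                ∎
      where
      open ≡-Reasoning
      ds = lowDigits (suc N) n
      |ds′| = trans (length-reverse ds) (length-lowDigits (suc N) n)
      fromDigits-ds′ : fromDigits (reverse ds) ≡ n
      fromDigits-ds′ = begin
        fromDigits (reverse ds)               ≡⟨ cong (fromDigits ∘ reverse) (digits≡lowDigits N b^N≤n n<b^1+N) ⟨
        fromDigits (reverse (digits b n))     ≡⟨ rev≡fromDigits-reverse n ⟨
        rev b n                               ≡⟨ rev≡n ⟩
        n                                     ∎

    0<n⇒∃[N]b^N≤n<b^[1+N] : ∀ {n} → 0 < n → ∃ λ N → b ^ N ≤ n × n < b ^ suc N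
    0<n⇒∃[N]b^N≤n<b^[1+N] {suc m} _ = go m
      where
      go : ∀ m → ∃ λ N → b ^ N ≤ suc m × suc m < b ^ suc N
      go zero = 0 , ≤-refl , subst (1 <_) (sym (*-identityʳ b)) 1<b
      go (suc m) with N , b^N≤ , <b^1+N ← go m with suc (suc m) <? b ^ suc N
      ... | yes <b^1+N′ = N , m≤n⇒m≤1+n b^N≤ , <b^1+N′
      ... | no  ≮b^1+N′ = suc N , ≮⇒≥ ≮b^1+N′ , ≤-<-trans <b^1+N (^-monoʳ-< b 1<b (n<1+n (suc N)))

    module _ (N t : ℕ) where
      private instance
        _ = m^n≢0 b t
        _ = m^n≢0 b (suc N ∸ t)

      palindrome⇒/≡mirror-% : ∀ {n} → b ^ N ≤ n → n < b ^ suc N → rev b n ≡ n → t ≤ suc N →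
        n / b ^ (suc N ∸ t) ≡ mirror t (n % b ^ t)
      palindrome⇒/≡mirror-% {n} b^N≤n n<b^1+N rev≡n t≤1+N =
        subst (λ m → m / b ^ (suc N ∸ t) ≡ mirror t (m % b ^ t)) (fromDigits-lowDigits (suc N) n<b^1+N)
          (palindrome-/ t (length-lowDigits (suc N) n) (lowDigits-digits (suc N) n)
            (palindrome-lowDigits N b^N≤n n<b^1+N rev≡n) t≤1+N)

    palindrome-rev : ∀ {ds c} → Digits ds → 0 < c → c < b → reverse (ds ∷ʳ c) ≡ ds ∷ʳ c →
      rev b (fromDigits (ds ∷ʳ c)) ≡ fromDigits (ds ∷ʳ c)
    palindrome-rev {ds} {c} ds<b 0<c c<b palindrome = begin
      rev b (fromDigits (ds ∷ʳ c))                         ≡⟨ rev≡fromDigits-reverse (fromDigits (ds ∷ʳ c)) ⟩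
      fromDigits (reverse (digits b (fromDigits (ds ∷ʳ c)))) ≡⟨ cong (fromDigits ∘ reverse) (digits-fromDigits ds<b 0<c c<b) ⟩
      fromDigits (reverse (ds ∷ʳ c))                       ≡⟨ cong fromDigits palindrome ⟩
      fromDigits (ds ∷ʳ c)                                 ∎
      where open ≡-Reasoning

module DivisiblePalindromes (b : ℕ) .{{_ : NonZero b}} (1<b : 1 < b) where
  open BaseDigits b

  divisiblePalindrome : ℕ → ℕ → Bool
  divisiblePalindrome d n = inP b n ∧ divB d n

  divisiblePalindrome⇒ : ∀ {d n} → T (divisiblePalindrome d n) → rev b n ≡ n × d ∣ n
  divisiblePalindrome⇒ {d} {n} h
    with inP , d∣n ← Equivalence.to (T-∧ {inP b n}) h
    with _ , rev≡n ← Equivalence.to (T-∧ {not (does (b ∣? n))}) inP =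
    ≡ᵇ⇒≡ (rev b n) n rev≡n , divB⇒∣ {d} d∣n

  count-below-divisor : ∀ {d y} → y < d → count (divisiblePalindrome d) y ≡ 0
  count-below-divisor {d} {y} y<d = count-zero (divisiblePalindrome d) y
    λ n 0<n n≤y h → <⇒≱ (≤-<-trans n≤y y<d) (∣⇒≤ {{>-nonZero 0<n}} (proj₂ (divisiblePalindrome⇒ h)))

  module _ (d N t : ℕ) .{{_ : NonZero d}} where
    private
      bᵗ = b ^ t
      W = b ^ (suc N ∸ t)
      instance
        _ = m^n≢0 b t
        _ = m^n≢0 b (suc N ∸ t)
        _ = m^n≢0 b N
        _ = m*n≢0 d bᵗ

    -- The top digits n / W of a palindrome n mirror its last t digits, which n % (d·b^t) determines.
    count-block : t ≤ suc N →
      count (divisiblePalindrome d) (pred (b ^ suc N)) ≤ W / d + 2 * bᵗ + count (divisiblePalindrome d) (pred (b ^ N))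
    count-block t≤1+N = count-≤-by-residue (divisiblePalindrome d) _ _ W start
      (pred-mono-≤ (^-monoʳ-≤ b (n≤1+n N))) located
      where
      start : ℕ → ℕ
      start r = mirror t (r % bᵗ) * W
      located : ∀ {n} → InWindow (divisiblePalindrome d) (pred (b ^ N)) (pred (b ^ suc N)) n →
        d ∣ n × start (n % (d * bᵗ)) ≤ n × n ≤ start (n % (d * bᵗ)) + W
      located {n} (lo<n , n≤hi , h) = d∣n , subst (_≤ n) (sym start≡) (m/n*n≤m n W) ,
        subst (n ≤_) (cong (_+ W) (sym start≡)) (≤-trans (<⇒≤ (m<[1+m/n]*n n W)) (≤-reflexive (+-comm W _)))
        where
        rev≡n = proj₁ (divisiblePalindrome⇒ {d} h)
        d∣n = proj₂ (divisiblePalindrome⇒ {d} h)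
        b^N≤n : b ^ N ≤ n
        b^N≤n = subst (_≤ n) (suc-pred (b ^ N)) lo<n
        n<b^1+N : n < b ^ suc N
        n<b^1+N = m≤pred[n]⇒suc[m]≤n {{m^n≢0 b (suc N)}} n≤hi
        start≡ : start (n % (d * bᵗ)) ≡ n / W * W
        start≡ = trans (cong (λ r → mirror t r * W) (m∣n⇒o%n%m≡o%m bᵗ (d * bᵗ) n (n∣m*n d)))
                       (cong (_* W) (sym (palindrome⇒/≡mirror-% 1<b N t b^N≤n n<b^1+N rev≡n t≤1+N)))

  b^[e+s]/d≤b^s : ∀ {d e} s .{{_ : NonZero d}} → b ^ e ≤ d → b ^ (e + s) / d ≤ b ^ s
  b^[e+s]/d≤b^s {d} {e} s b^e≤d = begin
    b ^ (e + s) / d         ≤⟨ /-monoʳ-≤ (b ^ (e + s)) b^e≤d ⟩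
    b ^ (e + s) / b ^ e     ≡⟨ cong (_/ b ^ e) (trans (^-distribˡ-+-* b e s) (*-comm (b ^ e) (b ^ s))) ⟩
    b ^ s * b ^ e / b ^ e   ≡⟨ m*n/n≡m (b ^ s) (b ^ e) ⟩
    b ^ s                   ∎
    where
    open ≤-Reasoning
    instance _ = m^n≢0 b e

  module _ (d e : ℕ) .{{_ : NonZero d}} (b^e≤d : b ^ e ≤ d) where
    private
      below : ℕ → ℕ
      below j = count (divisiblePalindrome d) (pred (b ^ (e + j)))

    count-step : ∀ j t → t ≤ suc j → suc j ∸ t ≤ t → below (suc j) ≤ 3 * b ^ t + below j
    count-step j t t≤1+j 1+j∸t≤t = begin
      below (suc j)                                   ≡⟨ cong (λ k → count (divisiblePalindrome d) (pred (b ^ k))) (+-suc e j) ⟩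
      count (divisiblePalindrome d) (pred (b ^ suc (e + j)))
                                                      ≤⟨ count-block d (e + j) t (≤-trans t≤1+j (s≤s (m≤n+m j e))) ⟩
      b ^ (suc (e + j) ∸ t) / d + 2 * b ^ t + below j ≡⟨ cong (λ k → b ^ k / d + 2 * b ^ t + below j) exponent ⟩
      b ^ (e + (suc j ∸ t)) / d + 2 * b ^ t + below j ≤⟨ +-monoˡ-≤ (below j) (+-monoˡ-≤ (2 * b ^ t) W/d≤b^t) ⟩
      b ^ t + 2 * b ^ t + below j                     ≡⟨⟩
      3 * b ^ t + below j                             ∎
      where
      open ≤-Reasoning
      exponent : suc (e + j) ∸ t ≡ e + (suc j ∸ t)
      exponent = trans (cong (_∸ t) (sym (+-suc e j))) (+-∸-assoc e t≤1+j)
      W/d≤b^t : b ^ (e + (suc j ∸ t)) / d ≤ b ^ t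
      W/d≤b^t = ≤-trans (b^[e+s]/d≤b^s {e = e} (suc j ∸ t) b^e≤d) (^-monoʳ-≤ b 1+j∸t≤t)

    count-≤-12*b^i : ∀ i → below (i + i) ≤ 12 * b ^ i
    count-≤-12*b^i zero = ≤-trans (≤-reflexive (count-below-divisor pred[b^e]<d)) z≤n
      where
      instance _ = m^n≢0 b (e + 0)
      pred[b^e]<d : pred (b ^ (e + 0)) < d
      pred[b^e]<d = subst (_≤ d) (sym (suc-pred (b ^ (e + 0)))) (subst (λ k → b ^ k ≤ d) (sym (+-identityʳ e)) b^e≤d)
    count-≤-12*b^i (suc i) = begin
      below (suc i + suc i)                        ≡⟨ cong (λ k → below (suc k)) (+-suc i i) ⟩
      below (suc (suc (i + i)))                    ≤⟨ upper-block ⟩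
      3 * b ^ suc i + below (suc (i + i))          ≤⟨ +-monoʳ-≤ (3 * b ^ suc i) lower-block ⟩
      3 * b ^ suc i + (3 * b ^ suc i + below (i + i)) ≤⟨ +-monoʳ-≤ (3 * b ^ suc i) (+-monoʳ-≤ (3 * b ^ suc i) (count-≤-12*b^i i)) ⟩
      3 * b ^ suc i + (3 * b ^ suc i + 12 * b ^ i) ≡⟨ regroup b (b ^ i) ⟩
      6 * (b * b ^ i) + 6 * (2 * b ^ i)        ≤⟨ +-monoʳ-≤ (6 * (b * b ^ i)) (*-monoʳ-≤ 6 (*-monoˡ-≤ (b ^ i) 1<b)) ⟩
      6 * (b * b ^ i) + 6 * (b * b ^ i)        ≡⟨ +-same (b * b ^ i) ⟩
      12 * b ^ suc i                           ∎
      where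
      open ≤-Reasoning
      regroup : ∀ b p → 3 * (b * p) + (3 * (b * p) + 12 * p) ≡ 6 * (b * p) + 6 * (2 * p)
      regroup = solve-∀
      +-same : ∀ x → 6 * x + 6 * x ≡ 12 * x
      +-same = solve-∀
      2+2i∸[1+i]≡1+i : suc (suc (i + i)) ∸ suc i ≡ suc i
      2+2i∸[1+i]≡1+i = trans (cong (_∸ i) (sym (+-suc i i))) (m+n∸m≡n i (suc i))
      upper-block = count-step (suc (i + i)) (suc i) (s≤s (m≤n⇒m≤1+n (m≤m+n i i))) (≤-reflexive 2+2i∸[1+i]≡1+i)
      lower-block = count-step (i + i) (suc i) (s≤s (m≤m+n i i)) (≤-trans (≤-reflexive (m+n∸m≡n i i)) (n≤1+n i))

    count-≤-12*b^⌈j/2⌉ : ∀ {x} j → x < b ^ (e + j) → count (divisiblePalindrome d) x ≤ 12 * b ^ ⌈ j /2⌉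
    count-≤-12*b^⌈j/2⌉ {x} j x<b^[e+j] = ≤-trans (count-monoʳ _ x≤) (count-≤-12*b^i ⌈ j /2⌉)
      where
      x≤ : x ≤ pred (b ^ (e + (⌈ j /2⌉ + ⌈ j /2⌉)))
      x≤ = <⇒≤pred (<-≤-trans x<b^[e+j] (^-monoʳ-≤ b (+-monoʳ-≤ e (proj₁ (⌈n/2⌉-bounds j)))))

  count²*d≤144*b^3*x : ∀ d x .{{_ : NonZero d}} →
    count (divisiblePalindrome d) x * count (divisiblePalindrome d) x * d ≤ 144 * b ^ 3 * x
  count²*d≤144*b^3*x d zero = z≤n
  count²*d≤144*b^3*x d x@(suc _)
    with e , b^e≤d , d<b^1+e ← 0<n⇒∃[N]b^N≤n<b^[1+N] 1<b (>-nonZero⁻¹ d)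
    with M , b^M≤x , x<b^1+M ← 0<n⇒∃[N]b^N≤n<b^[1+N] 1<b {x} (s≤s z≤n)
    with suc M ≤? e
  ... | yes 1+M≤e rewrite count-below-divisor (<-≤-trans x<b^1+M (≤-trans (^-monoʳ-≤ b 1+M≤e) b^e≤d)) = z≤n
  ... | no  1+M≰e = begin
    C * C * d                             ≤⟨ *-mono-≤ (*-mono-≤ C≤ C≤) (<⇒≤ d<b^1+e) ⟩
    12 * b ^ i * (12 * b ^ i) * b ^ suc e ≡⟨ regroup (b ^ i) (b ^ suc e) ⟩
    144 * (b ^ i * b ^ i * b ^ suc e)     ≡⟨ cong (144 *_) b^[i+i+1+e] ⟨
    144 * b ^ (i + i + suc e)             ≤⟨ *-monoʳ-≤ 144 (^-monoʳ-≤ b i+i+1+e≤3+M) ⟩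
    144 * b ^ (3 + M)                     ≡⟨ trans (cong (144 *_) (^-distribˡ-+-* b 3 M)) (sym (*-assoc 144 (b ^ 3) (b ^ M))) ⟩
    144 * b ^ 3 * b ^ M                   ≤⟨ *-monoʳ-≤ (144 * b ^ 3) b^M≤x ⟩
    144 * b ^ 3 * x                       ∎
    where
    open ≤-Reasoning
    C = count (divisiblePalindrome d) x
    j = suc M ∸ e
    i = ⌈ j /2⌉
    e+j≡1+M : e + j ≡ suc M
    e+j≡1+M = m+[n∸m]≡n (≰⇒≥ 1+M≰e)
    C≤ : C ≤ 12 * b ^ i
    C≤ = count-≤-12*b^⌈j/2⌉ d e b^e≤d j (subst (λ k → x < b ^ k) (sym e+j≡1+M) x<b^1+M)
    regroup : ∀ p q → 12 * p * (12 * p) * q ≡ 144 * (p * p * q)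
    regroup = solve-∀
    b^[i+i+1+e] : b ^ (i + i + suc e) ≡ b ^ i * b ^ i * b ^ suc e
    b^[i+i+1+e] = trans (^-distribˡ-+-* b (i + i) (suc e)) (cong (_* b ^ suc e) (^-distribˡ-+-* b i i))
    i+i+1+e≤3+M : i + i + suc e ≤ 3 + M
    i+i+1+e≤3+M = begin
      i + i + suc e     ≤⟨ +-monoˡ-≤ (suc e) (proj₂ (⌈n/2⌉-bounds j)) ⟩
      suc j + suc e     ≡⟨ cong suc (trans (+-suc j e) (cong suc (trans (+-comm j e) e+j≡1+M))) ⟩
      3 + M             ∎

module CoprimePalindromes (b : ℕ) .{{_ : NonZero b}} (1<b : 1 < b) where
  open BaseDigits b

  q : ℕ
  q = b * b ∸ 1

  1+q≡b*b : suc q ≡ b * b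
  1+q≡b*b = m+[n∸m]≡n (*-mono-≤ (<⇒≤ 1<b) (<⇒≤ 1<b))

  1<q : 1 < q
  1<q = ≤-trans (s≤s (s≤s z≤n)) (∸-monoˡ-≤ 1 (*-mono-≤ 1<b 1<b))

  instance
    q≢0 : NonZero q
    q≢0 = >-nonZero (<-trans (s≤s z≤n) 1<q)

  open Congruence q

  b*b≋1 : b * b ≋ 1
  b*b≋1 = subst (λ x → x ≋ 1) 1+q≡b*b ([m+n]%n≡m%n 1 q)

  b^[k+k]≋1 : ∀ k → b ^ (k + k) ≋ 1
  b^[k+k]≋1 zero = ≋-refl
  b^[k+k]≋1 (suc k) = begin
    b * b ^ (k + suc k)     ≡⟨ cong (λ e → b * b ^ e) (+-suc k k) ⟩
    b * (b * b ^ (k + k))   ≡⟨ *-assoc b b _ ⟨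
    b * b * b ^ (k + k)     ≈⟨ *-≋ b*b≋1 (b^[k+k]≋1 k) ⟩
    1                       ∎
    where open ≋-Reasoning

  -- Digit i of h sits at position |h|−1−i of reverse h; the factor b^(|h|+1) moves it to weight
  -- b^(2|h|−i) ≋ b^i.
  fromDigits-reverse-≋ : ∀ h → fromDigits (reverse h) * b ^ suc (length h) ≋ fromDigits h
  fromDigits-reverse-≋ [] = ≋-refl
  fromDigits-reverse-≋ (x ∷ h) = begin
    fromDigits (reverse (x ∷ h)) * b ^ (2 + k)             ≡⟨ cong (λ ds → fromDigits ds * b ^ (2 + k)) (unfold-reverse x h) ⟩
    fromDigits (reverse h ∷ʳ x) * b ^ (2 + k)               ≡⟨ cong (_* b ^ (2 + k)) (fromDigits-++ (reverse h) [ x ]) ⟩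
    (r + x * b ^ length (reverse h)) * b ^ (2 + k)          ≡⟨ cong (λ e → (r + x * b ^ e) * b ^ (2 + k)) (length-reverse h) ⟩
    (r + x * b ^ k) * (b * (b * b ^ k))                     ≡⟨ regroup r x b (b ^ k) ⟩
    r * (b * b ^ k) * b + b * b * (b ^ k * b ^ k) * x       ≡⟨ cong (λ P → r * (b * b ^ k) * b + b * b * P * x) (^-distribˡ-+-* b k k) ⟨
    r * b ^ suc k * b + b * b * b ^ (k + k) * x             ≈⟨ +-≋ (*-≋ (fromDigits-reverse-≋ h) ≋-refl) (*-≋ b^[2+k+k]≋1 ≋-refl) ⟩
    fromDigits h * b + 1 * x                                ≡⟨ cong (fromDigits h * b +_) (*-identityˡ x) ⟩
    fromDigits (x ∷ h)                                      ∎
    where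
    open ≋-Reasoning
    k = length h
    r = fromDigits (reverse h)
    b^[2+k+k]≋1 = *-≋ b*b≋1 (b^[k+k]≋1 k)
    regroup : ∀ r x b p → (r + x * p) * (b * (b * p)) ≡ r * (b * p) * b + b * b * (p * p) * x
    regroup = solve-∀

  fromDigits-odd-palindrome-≋ : ∀ h m {k} → length h ≡ k + k →
    fromDigits (h ++ m ∷ reverse h) ≋ fromDigits h + fromDigits h + m
  fromDigits-odd-palindrome-≋ h m {k} |h|≡k+k = begin
    fromDigits (h ++ m ∷ reverse h)                            ≡⟨ fromDigits-++ h (m ∷ reverse h) ⟩
    fromDigits h + (r * b + m) * b ^ length h                  ≈⟨ +-≋ (≋-refl {fromDigits h}) (*-≋ (≋-refl {r * b + m}) b^|h|≋1) ⟩
    fromDigits h + (r * b + m) * 1                             ≡⟨ cong (fromDigits h +_) (*-identityʳ _) ⟩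
    fromDigits h + (r * b + m)                                 ≈⟨ +-≋ (≋-refl {fromDigits h}) (+-≋ reflected ≋-refl) ⟩
    fromDigits h + (fromDigits h + m)                        ≡⟨ +-assoc (fromDigits h) _ m ⟨
    fromDigits h + fromDigits h + m                          ∎
    where
    open ≋-Reasoning
    r = fromDigits (reverse h)
    b^|h|≋1 : b ^ length h ≋ 1
    b^|h|≋1 = subst (λ e → b ^ e ≋ 1) (sym |h|≡k+k) (b^[k+k]≋1 k)
    reflected : r * b ≋ fromDigits h
    reflected = begin
      r * b                       ≡⟨ *-identityʳ _ ⟨
      r * b * 1                   ≈⟨ *-≋ (≋-refl {r * b}) (≋-sym b^|h|≋1) ⟩
      r * b * b ^ length h        ≡⟨ *-assoc r b _ ⟩
      r * b ^ suc (length h)      ≈⟨ fromDigits-reverse-≋ h ⟩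
      fromDigits h                ∎

  b^3∸b≡b*q : b ^ 3 ∸ b ≡ b * q
  b^3∸b≡b*q = sym (begin
    b * (b * b ∸ 1)         ≡⟨ *-distribˡ-∸ b (b * b) 1 ⟩
    b * (b * b) ∸ b * 1     ≡⟨ cong₂ (λ u v → b * (b * u) ∸ v) (sym (*-identityʳ b)) (*-identityʳ b) ⟩
    b ^ 3 ∸ b               ∎)
    where open ≡-Reasoning

  inP*-intro : ∀ {n} → n % b ≡ 1 → n ≋ 1 → rev b n ≡ n → T (inP* b n)
  inP*-intro {n} n%b≡1 n≋1 rev≡n = Equivalence.from T-∧ (≡⇒≡ᵇ _ _ gcd≡1 , ≡⇒≡ᵇ _ _ rev≡n)
    where
    n%q≡1 : n % q ≡ 1
    n%q≡1 = trans n≋1 (m<n⇒m%n≡m 1<q)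
    gcd≡1 : gcd n (b ^ 3 ∸ b) ≡ 1
    gcd≡1 = subst (λ k → gcd n k ≡ 1) (sym b^3∸b≡b*q)
              (coprime⇒gcd≡1 (coprime-* {n} {b} {q} (%≡1⇒coprime n%b≡1) (%≡1⇒coprime n%q≡1)))

  -- The palindrome 1 a c F m F̃ c a 1 is ≋ R + τ with τ = m + 2(c + a·b); so τ is chosen first,
  -- as the residue with R + τ ≋ 1, and m, c, a are read off from it.
  module Construction (F : List ℕ) where
    R τ a c m : ℕ
    R = 2 * (fromDigits F * b + 1)
    τ = (suc q ∸ R % q) % q
    a = τ / 2 / b
    c = τ / 2 % b
    m = τ % 2

    half digits′ : List ℕ
    half = 1 ∷ a ∷ c ∷ F
    digits′ = half ++ m ∷ reverse half

    R+τ≋1 : R + τ ≋ 1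
    R+τ≋1 = begin
      R + τ                       ≈⟨ +-≋ (≋-sym (%-≋ R)) (%-≋ (suc q ∸ R % q)) ⟩
      R % q + (suc q ∸ R % q)     ≡⟨ m+[n∸m]≡n (m≤n⇒m≤1+n (m%n≤n R q)) ⟩
      1 + q                       ≈⟨ [m+n]%n≡m%n 1 q ⟩
      1                           ∎
      where open ≋-Reasoning

    half≋ : fromDigits half ≋ fromDigits F * b + 1 + τ / 2
    half≋ = begin
      ((fromDigits F * b + c) * b + a) * b + 1       ≡⟨ regroup (fromDigits F * b) c a b ⟩
      b * b * (fromDigits F * b + c) + (a * b + 1)   ≈⟨ +-≋ (*-≋ b*b≋1 ≋-refl) ≋-refl ⟩
      1 * (fromDigits F * b + c) + (a * b + 1)       ≡⟨ regroup′ (fromDigits F * b) c a b ⟩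
      fromDigits F * b + 1 + (c + a * b)             ≡⟨ cong (fromDigits F * b + 1 +_) (m≡m%n+[m/n]*n (τ / 2) b) ⟨
      fromDigits F * b + 1 + τ / 2                   ∎
      where
      open ≋-Reasoning
      regroup : ∀ v c a b → ((v + c) * b + a) * b + 1 ≡ b * b * (v + c) + (a * b + 1)
      regroup = solve-∀
      regroup′ : ∀ v c a b → 1 * (v + c) + (a * b + 1) ≡ v + 1 + (c + a * b)
      regroup′ = solve-∀

    digits′≋1 : ∀ {k} → length half ≡ k + k → fromDigits digits′ ≋ 1
    digits′≋1 {k} |half|≡k+k = begin
      fromDigits digits′                                 ≈⟨ fromDigits-odd-palindrome-≋ half m {k} |half|≡k+k ⟩
      fromDigits half + fromDigits half + m              ≈⟨ +-≋ (+-≋ half≋ half≋) ≋-refl ⟩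
      (X + τ / 2) + (X + τ / 2) + τ % 2                  ≡⟨ regroup X (τ / 2) (τ % 2) ⟩
      R + (τ % 2 + τ / 2 * 2)                            ≡⟨ cong (R +_) (m≡m%n+[m/n]*n τ 2) ⟨
      R + τ                                              ≈⟨ R+τ≋1 ⟩
      1                                                  ∎
      where
      open ≋-Reasoning
      X = fromDigits F * b + 1
      regroup : ∀ x y z → (x + y) + (x + y) + z ≡ 2 * x + (z + y * 2)
      regroup = solve-∀

    half-digits : Digits F → Digits half
    half-digits F<b = 1<b ∷ a<b ∷ m%n<n (τ / 2) b ∷ F<b
      where
      τ/2<b*b : τ / 2 < b * b
      τ/2<b*b = ≤-<-trans (m/n≤m τ 2) (<-≤-trans (m%n<n _ q) (≤-trans (n≤1+n q) (≤-reflexive 1+q≡b*b)))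
      a<b = m<n*o⇒m/o<n τ/2<b*b

    body : List ℕ
    body = half ++ m ∷ reverse (a ∷ c ∷ F)

    body-digits : Digits F → Digits body
    body-digits F<b with half<b@(_ ∷ rest<b) ← half-digits F<b =
      All.++⁺ half<b (≤-trans (m%n<n τ 2) 1<b ∷ All-reverse⁺ rest<b)

    digits′≡body∷ʳ1 : digits′ ≡ body ∷ʳ 1
    digits′≡body∷ʳ1 = cong (1 ∷_) (trans (cong (λ xs → a ∷ c ∷ F ++ m ∷ xs) (unfold-reverse 1 (a ∷ c ∷ F)))
                                         (sym (++-assoc (a ∷ c ∷ F) (m ∷ reverse (a ∷ c ∷ F)) [ 1 ])))

  family : ℕ → ℕ → ℕ
  family r i = fromDigits (Construction.digits′ (lowDigits (suc (r + r)) i))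

  family⁻¹ : ℕ → ℕ → ℕ
  family⁻¹ r n = n / b ^ 3 % b ^ suc (r + r)
    where instance
      _ = m^n≢0 b 3
      _ = m^n≢0 b (suc (r + r))

  module _ (r i : ℕ) where
    private
      F = lowDigits (suc (r + r)) i
      F<b = lowDigits-digits (suc (r + r)) i
      |F| = length-lowDigits (suc (r + r)) i
      instance
        _ = m^n≢0 b 3
        _ = m^n≢0 b (suc (r + r))
    open Construction F

    family%b≡1 : family r i % b ≡ 1
    family%b≡1 = trans (cong (_% b) (+-comm (rest * b) 1)) ([m+kn]%n≡m rest b 1<b)
      where rest = fromDigits (a ∷ c ∷ F ++ m ∷ reverse half)

    family-inP* : T (inP* b (family r i))
    family-inP* = inP*-intro family%b≡1 (digits′≋1 {suc (suc r)} |half|≡) palindrome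
      where
      |half|≡ : length half ≡ suc (suc r) + suc (suc r)
      |half|≡ = trans (cong (3 +_) |F|) (regroup r)
        where
        regroup : ∀ r → 3 + suc (r + r) ≡ suc (suc r) + suc (suc r)
        regroup = solve-∀
      palindrome : rev b (fromDigits digits′) ≡ fromDigits digits′
      palindrome = subst (λ ds → rev b (fromDigits ds) ≡ fromDigits ds) (sym digits′≡body∷ʳ1)
        (palindrome-rev 1<b (body-digits F<b) (s≤s z≤n) 1<b
          (subst (λ ds → reverse ds ≡ ds) digits′≡body∷ʳ1 (reverse-odd-palindrome half m)))

    family-< : family r i < b ^ (4 * r + 9)
    family-< = subst (λ k → family r i < b ^ k) |digits′|
      (subst (λ ds → fromDigits ds < b ^ length ds) (sym digits′≡body∷ʳ1) (fromDigits-< (All.∷ʳ⁺ (body-digits F<b) 1<b)))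
      where
      |digits′| : length digits′ ≡ 4 * r + 9
      |digits′| = begin
        length (half ++ m ∷ reverse half)        ≡⟨ length-++ half ⟩
        length half + suc (length (reverse half)) ≡⟨ cong (λ k → length half + suc k) (length-reverse half) ⟩
        3 + length F + suc (3 + length F)        ≡⟨ cong (λ k → 3 + k + suc (3 + k)) |F| ⟩
        3 + suc (r + r) + suc (3 + suc (r + r))  ≡⟨ regroup r ⟩
        4 * r + 9                                ∎
        where
        open ≡-Reasoning
        regroup : ∀ r → 3 + suc (r + r) + suc (3 + suc (r + r)) ≡ 4 * r + 9
        regroup = solve-∀

    family⁻¹-family : i < b ^ suc (r + r) → family⁻¹ r (family r i) ≡ i
    family⁻¹-family i<b^K = begin
      fromDigits ((1 ∷ a ∷ c ∷ []) ++ F ++ m ∷ reverse half) / b ^ 3 % b ^ suc (r + r)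
        ≡⟨ cong (_% b ^ suc (r + r)) (fromDigits-++-/ (All.take⁺ 3 (half-digits F<b)) (F ++ m ∷ reverse half) refl) ⟩
      fromDigits (F ++ m ∷ reverse half) % b ^ suc (r + r)    ≡⟨ fromDigits-++-% F<b (m ∷ reverse half) |F| ⟩
      fromDigits F                                            ≡⟨ fromDigits-lowDigits (suc (r + r)) i<b^K ⟩
      i                                                       ∎
      where open ≡-Reasoning

  b^[1+2r]≤count-inP* : ∀ r {x} → b ^ (4 * r + 9) ≤ x → b ^ suc (r + r) ≤ count (inP* b) x
  b^[1+2r]≤count-inP* r {x} b^[4r+9]≤x = ≤-count (inP* b) x _ (family r)
    (λ {i} _ → ≤-trans (≤-reflexive (sym (family%b≡1 r i))) (m%n≤m _ b) ,
               ≤-trans (<⇒≤ (family-< r i)) b^[4r+9]≤x , family-inP* r i)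
    (λ {i} {j} i< j< family≡ → trans (sym (family⁻¹-family r i i<)) (trans (cong (family⁻¹ r) family≡) (family⁻¹-family r j j<)))

  1∈P* : T (inP* b 1)
  1∈P* = inP*-intro (m<n⇒m%n≡m 1<b) ≋-refl (palindrome-rev 1<b [] (s≤s z≤n) 1<b refl)

  x≤b^13*P*² : ∀ {x} → 0 < x → x ≤ b ^ 13 * (count (inP* b) x * count (inP* b) x)
  x≤b^13*P*² {x} 0<x with M , b^M≤x , x<b^1+M ← 0<n⇒∃[N]b^N≤n<b^[1+N] 1<b 0<x with 9 ≤? M
  ... | no 9≰M = begin
    x                                     ≤⟨ <⇒≤ x<b^1+M ⟩
    b ^ suc M                             ≤⟨ ^-monoʳ-≤ b (≤-trans (≰⇒> 9≰M) (m≤m+n 9 4)) ⟩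
    b ^ 13                                ≡⟨ *-identityʳ (b ^ 13) ⟨
    b ^ 13 * 1                            ≤⟨ *-monoʳ-≤ (b ^ 13) (*-mono-≤ 1≤P* 1≤P*) ⟩
    b ^ 13 * (count (inP* b) x * count (inP* b) x) ∎
    where
    open ≤-Reasoning
    1≤P* : 1 ≤ count (inP* b) x
    1≤P* = ≤-count (inP* b) x 1 (λ _ → 1) (λ _ → s≤s z≤n , 0<x , 1∈P*)
      λ i<1 j<1 _ → trans (n<1⇒n≡0 i<1) (sym (n<1⇒n≡0 j<1))
  ... | yes 9≤M = begin
    x                                         ≤⟨ <⇒≤ x<b^1+M ⟩
    b ^ suc M                                 ≤⟨ ^-monoʳ-≤ b 1+M≤ ⟩
    b ^ (suc (r + r) + suc (r + r) + 11)      ≡⟨ b^[K+K+11] ⟩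
    b ^ suc (r + r) * b ^ suc (r + r) * b ^ 11 ≤⟨ *-mono-≤ (*-mono-≤ K≤P* K≤P*) (^-monoʳ-≤ b (m≤m+n 11 2)) ⟩
    count (inP* b) x * count (inP* b) x * b ^ 13 ≡⟨ *-comm _ (b ^ 13) ⟩
    b ^ 13 * (count (inP* b) x * count (inP* b) x) ∎
    where
    open ≤-Reasoning
    r = (M ∸ 9) / 4
    M≡ : M ≡ M ∸ 9 + 9
    M≡ = sym (m∸n+n≡m 9≤M)
    K≤P* : b ^ suc (r + r) ≤ count (inP* b) x
    K≤P* = b^[1+2r]≤count-inP* r (≤-trans (^-monoʳ-≤ b 4r+9≤M) b^M≤x)
      where
      4r+9≤M : 4 * r + 9 ≤ M
      4r+9≤M = subst (4 * r + 9 ≤_) (sym M≡) (+-monoˡ-≤ 9 (subst (_≤ M ∸ 9) (*-comm r 4) (m/n*n≤m (M ∸ 9) 4)))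
    1+M≤ : suc M ≤ suc (r + r) + suc (r + r) + 11
    1+M≤ = begin
      suc M                           ≡⟨ cong suc M≡ ⟩
      suc (M ∸ 9 + 9)                 ≤⟨ +-monoˡ-≤ 9 (m<[1+m/n]*n (M ∸ 9) 4) ⟩
      suc r * 4 + 9                   ≡⟨ regroup r ⟩
      suc (r + r) + suc (r + r) + 11  ∎
      where
      regroup : ∀ r → suc r * 4 + 9 ≡ suc (r + r) + suc (r + r) + 11
      regroup = solve-∀
    b^[K+K+11] : b ^ (suc (r + r) + suc (r + r) + 11) ≡ b ^ suc (r + r) * b ^ suc (r + r) * b ^ 11
    b^[K+K+11] = trans (^-distribˡ-+-* b (suc (r + r) + suc (r + r)) 11) (cong (_* b ^ 11) (^-distribˡ-+-* b (suc (r + r)) (suc (r + r))))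

  inP*⇒inP : ∀ n → T (inP* b n) → T (inP b n)
  inP*⇒inP n h with gcd≡1 , rev≡n ← Equivalence.to (T-∧ {gcd n (b ^ 3 ∸ b) ≡ᵇ 1}) h with b ∣? n
  ... | yes b∣n = contradiction (∣1⇒≡1 (subst (b ∣_) (≡ᵇ⇒≡ _ 1 gcd≡1) b∣gcd)) (>⇒≢ 1<b)
    where b∣gcd = gcd-greatest b∣n (subst (b ∣_) (sym b^3∸b≡b*q) (m∣m*n q))
  ... | no _ = rev≡n

lemma3p4 : (b : ℕ) → .{{_ : NonZero b}} → 2 ≤ b →
    ∃ λ (C : ℕ) → (d x : ℕ) → 1 ≤ d → 1 ≤ x →
      ((count (λ n → inP b n ∧ divB d n) x * count (λ n → inP b n ∧ divB d n) x) * d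
          ≤ (C * C) * (count (inP b) x * count (inP b) x))
      × ((count (λ n → inP* b n ∧ divB d n) x * count (λ n → inP* b n ∧ divB d n) x) * d
          ≤ (C * C) * (count (inP* b) x * count (inP* b) x))
lemma3p4 b 1<b = C , λ d x 1≤d 1≤x → let instance _ = >-nonZero 1≤d in
    ≤-trans (A²d≤C*P*² d x 1≤x) (*-mono-≤ C≤C*C (*-mono-≤ (P*≤P x) (P*≤P x))) ,
    ≤-trans (*-monoˡ-≤ d (*-mono-≤ (A*≤A d x) (A*≤A d x))) (≤-trans (A²d≤C*P*² d x 1≤x) (*-monoˡ-≤ _ C≤C*C))
  where
  open DivisiblePalindromes b 1<b
  open CoprimePalindromes b 1<b
  C = 144 * b ^ 3 * b ^ 13
  C≤C*C : C ≤ C * C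
  C≤C*C = m≤m*n C C {{m*n≢0 _ _ {{m*n≢0 144 (b ^ 3) {{_}} {{m^n≢0 b 3}}}} {{m^n≢0 b 13}}}}
  P*≤P : ∀ x → count (inP* b) x ≤ count (inP b) x
  P*≤P x = count-monoˡ x inP*⇒inP
  A*≤A : ∀ d x → count (λ n → inP* b n ∧ divB d n) x ≤ count (divisiblePalindrome d) x
  A*≤A d x = count-monoˡ x λ n → T-∧-monoˡ (inP*⇒inP n)
  A²d≤C*P*² : ∀ d x .{{_ : NonZero d}} → 1 ≤ x →
    count (divisiblePalindrome d) x * count (divisiblePalindrome d) x * d ≤ C * (count (inP* b) x * count (inP* b) x)
  A²d≤C*P*² d x 1≤x = begin
    count (divisiblePalindrome d) x * count (divisiblePalindrome d) x * d ≤⟨ count²*d≤144*b^3*x d x ⟩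
    144 * b ^ 3 * x                                                 ≤⟨ *-monoʳ-≤ (144 * b ^ 3) (x≤b^13*P*² 1≤x) ⟩
    144 * b ^ 3 * (b ^ 13 * (count (inP* b) x * count (inP* b) x))  ≡⟨ *-assoc (144 * b ^ 3) (b ^ 13) _ ⟨
    C * (count (inP* b) x * count (inP* b) x)                       ∎
    where open ≤-Reasoning
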